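{- Let $D$ be the formal derivative with respect to the context-free grammar $G\colon x\to xy,\ y\to xz,\ z\to zw,\ w\to xz$. For $n\ge 0$ let $$P_n(x,y,z,w)=\sum_{i,j}P_n(i,j)\,x^i y^j z^{i+1} w^{n-2i-j},$$ where $P_n(i,j)$ is the number of permutations of $[n]=\{1,\dots,n\}$ with $i$ exterior peaks and $j$ proper double descents. Then for all $n\ge 0$, $$D^n(z)=P_n(x,y,z,w).$$
   Context: Let $x,y,z,w$ be commuting variables. The formal derivative $D$ with respect to the grammar $G$ is the linear operator on Laurent polynomials in $x,y,z,w$ satisfying $D(uv)=uD(v)+vD(u)$, $D(c)=0$ for constants $c$, and $D(x)=xy$, $D(y)=xz$, $D(z)=zw$, $D(w)=xz$; $D^0$ is the identity. For a permutation $\pi=\pi_1\pi_2\cdots\pi_n$ of $[n]$, an index $i$ is an exterior peak if either $i=1$ and $\pi_1>\pi_2$ (requiring $n\ge 2$), or $1<i<n$ and $\pi_{i-1}<\pi_i>\pi_{i+1}$. An index $i$ is a proper double descent if $3\le i\le n$ and $\pi_{i-2}>\pi_{i-1}>\pi_i$. For $n=0$ the empty permutation is counted once with $0$ exterior peaks and $0$ proper double descents, so $P_0=z$. -}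

module Defs where

open import Data.Nat as ℕ using (ℕ; zero; suc; _<ᵇ_)
open import Data.Integer as ℤ using (ℤ; +_; _*_; _+_; _-_; 1ℤ; 0ℤ)
open import Data.Integer.Properties using () renaming (_≟_ to _≟ℤ_)
open import Data.Product using (_×_; _,_)
open import Data.Product.Properties using (≡-dec)
open import Data.Bool using (Bool; true; false; if_then_else_; _∧_)
open import Data.List using (List; []; _∷_; concatMap; map; filter; length; upTo; allFin)
open import Data.Fin using (Fin; toℕ)
open import Data.Vec as Vec using (Vec; toList)
open import Data.List.Relation.Unary.Unique.Propositional using (Unique)
open import Data.List.Relation.Unary.Unique.DecPropositional using (unique?)
open import Data.Fin.Properties using () renaming (_≟_ to _≟F_)
open import Relation.Nullary using (Dec; yes; no; does)
open import Relation.Nullary.Decidable using (_×-dec_)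
open import Relation.Binary.PropositionalEquality using (_≡_)
open import Function using (_∘_)

-- Laurent polynomials in x,y,z,w with integer coefficients,
-- represented as finite lists of terms  c · x^a y^b z^c w^d .
-- Two such lists represent the same Laurent polynomial iff all their
-- coefficients (computed by `coeff`) agree.

Exponent : Set
Exponent = ℤ × ℤ × ℤ × ℤ

_≟E_ : (e f : Exponent) → Dec (e ≡ f)
_≟E_ = ≡-dec _≟ℤ_ (≡-dec _≟ℤ_ (≡-dec _≟ℤ_ _≟ℤ_))

Term : Set
Term = ℤ × Exponent

LPoly : Set
LPoly = List Term

coeff : LPoly → Exponent → ℤ
coeff [] e = 0ℤ
coeff ((c , e′) ∷ p) e = (if does (e′ ≟E e) then c else 0ℤ) + coeff p e

-- By the Leibniz rule,
--   D(x^a y^b z^c w^d) = a x^a y^(b+1) z^c w^d + b x^(a+1) y^(b-1) z^(c+1) w^d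
--                      + c x^a y^b z^c w^(d+1) + d x^(a+1) y^b z^(c+1) w^(d-1)
-- and D extends linearly.

DTerm : Term → LPoly
DTerm (k , (a , b , c , d)) =
  (k * a , (a , b + 1ℤ , c , d)) ∷
  (k * b , (a + 1ℤ , b - 1ℤ , c + 1ℤ , d)) ∷
  (k * c , (a , b , c , d + 1ℤ)) ∷
  (k * d , (a + 1ℤ , b , c + 1ℤ , d - 1ℤ)) ∷ []

D : LPoly → LPoly
D = concatMap DTerm

Dⁿ : ℕ → LPoly → LPoly
Dⁿ zero p = p
Dⁿ (suc n) p = D (Dⁿ n p)

zPoly : LPoly
zPoly = (1ℤ , (0ℤ , 0ℤ , 1ℤ , 0ℤ)) ∷ []

b2n : Bool → ℕ
b2n true = 1
b2n false = 0

interiorPeaks : List ℕ → ℕ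
interiorPeaks (a ∷ b ∷ c ∷ r) = b2n ((a <ᵇ b) ∧ (c <ᵇ b)) ℕ.+ interiorPeaks (b ∷ c ∷ r)
interiorPeaks _ = 0

exteriorPeaks : List ℕ → ℕ
exteriorPeaks (a ∷ b ∷ r) = b2n (b <ᵇ a) ℕ.+ interiorPeaks (a ∷ b ∷ r)
exteriorPeaks _ = 0

properDoubleDescents : List ℕ → ℕ
properDoubleDescents (a ∷ b ∷ c ∷ r) = b2n ((b <ᵇ a) ∧ (c <ᵇ b)) ℕ.+ properDoubleDescents (b ∷ c ∷ r)
properDoubleDescents _ = 0

-- Permutations of [n]: words of length n over Fin n (value k stands for
-- k+1 ∈ [n]) with no repeated letter.

allWords : (n k : ℕ) → List (Vec (Fin n) k)
allWords n zero = Vec.[] ∷ []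
allWords n (suc k) = concatMap (λ i → map (i Vec.∷_) (allWords n k)) (allFin n)

word : ∀ {n} → Vec (Fin n) n → List ℕ
word v = Data.List.map toℕ (toList v)

permutations : (n : ℕ) → List (Vec (Fin n) n)
permutations n = filter (λ v → unique? _≟F_ (toList v)) (allWords n n)

Pcount : ℕ → ℕ → ℕ → ℕ
Pcount n i j = length (filter (λ v → (exteriorPeaks (word v) ℕ.≟ i) ×-dec
                                       (properDoubleDescents (word v) ℕ.≟ j))
                               (permutations n))

-- P_n(x,y,z,w) = Σ_{i,j} P_n(i,j) x^i y^j z^(i+1) w^(n-2i-j)
-- (P_n(i,j) = 0 unless i, j ≤ n, so i, j range over 0..n)
P : ℕ → LPoly
P n = concatMap (λ i → map (λ j → (+ Pcount n i j ,
          (+ i , + j , + i + 1ℤ , + n - (+ 2 * + i) - + j)))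
        (upTo (suc n))) (upTo (suc n))

module Submission where

-- Both sides are compared, coefficient by coefficient, with the same sum taken
-- over `perms n`, the permutations of {0, …, n-1} obtained by inserting the
-- largest letter into the permutations of {0, …, n-2}.
--  * D^n(z) (`Dⁿz≡permPoly`), by induction on n.  D respects equality of
--    coefficients (`D-cong`), so it suffices to differentiate one monomial
--    (`D-monomialOf`).  This is the grammatical labelling: put a sentinel 0
--    in front of π and a sentinel ∞ behind it; each of the n + 1 gaps gets a
--    kind X, Y, Z or W; there are as many gaps of kind ℓ as the degree of ℓ
--    in the monomial of π (`kind-counts`); and inserting the new largest
--    letter into a gap of kind ℓ changes the monomial exactly as the
--    production of ℓ does (`gap-step`, `monomial-step`).  Peaks and double
--    descents are counted as windows of three consecutive letters, so an
--    insertion only changes the windows next to it (`windows-insert`).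
--  * P_n (`coeff-P`): P_n groups the permutations enumerated in the statement
--    by their two statistics (`Σ-fibres`), and these permutations are a
--    rearrangement of `perms n`, both lists being duplicate-free with the
--    same members (`permutation-words↭perms`).

open import Defs

open import Data.Nat as ℕ using (ℕ; zero; suc; _<ᵇ_; _<_; _≤_; z≤n; s≤s)
open import Relation.Binary.PropositionalEquality
open import Data.Bool using (Bool; true; false; if_then_else_; _∧_; not)
open import Data.Bool.Properties using (∧-zeroʳ)
open import Data.Empty using (⊥-elim)
open import Data.Fin using (Fin; toℕ; fromℕ<)
open import Data.Fin.Properties using (toℕ-injective; toℕ<n; toℕ-fromℕ<) renaming (_≟_ to _≟F_)
open import Data.Integer as ℤ using (ℤ; +_; 0ℤ; 1ℤ)
import Data.Integer.Properties as ℤP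
open import Data.Integer.Tactic.RingSolver using (solve-∀)
open import Data.List using (List; []; _∷_; map; _++_; concatMap; length; filter; upTo; reverseAcc)
open import Data.List.Properties
  using (map-∘; concatMap-map; length-++; length-map; ∷-injectiveˡ; ∷-injectiveʳ; filter-accept; filter-reject; filter-all)
open import Data.List.Membership.Propositional using (_∈_; _∉_)
open import Data.List.Membership.Propositional.Properties
  using (∈-map⁺; ∈-map⁻; ∈-concat⁺′; ∈-concat⁻′; ∈-∃++; ∈-filter⁺; ∈-filter⁻; ∈-allFin; ∈-upTo⁺)
open import Data.List.Membership.Propositional.Properties.WithK using (unique∧set⇒bag)
open import Data.List.Membership.DecPropositional ℕ._≟_ using (_∈?_)
open import Data.List.Relation.Binary.BagAndSetEquality using (∼bag⇒↭)
open import Data.List.Relation.Binary.Disjoint.Propositional using (Disjoint)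
open import Data.List.Relation.Binary.Permutation.Propositional
  using (_↭_; ↭-refl; ↭-prep; ↭-swap; ↭-sym; ↭-trans; ↭⇒↭ₛ)
import Data.List.Relation.Binary.Permutation.Propositional.Properties as ↭
open import Data.List.Relation.Binary.Permutation.Setoid.Properties (setoid ℕ) using (Unique-resp-↭)
open import Data.List.Relation.Unary.All as All using (All; []; _∷_)
import Data.List.Relation.Unary.All.Properties as All
open import Data.List.Relation.Unary.AllPairs as AllPairs using (AllPairs; []; _∷_)
import Data.List.Relation.Unary.AllPairs.Properties as APP
open import Data.List.Relation.Unary.Any using (here; there)
open import Data.List.Relation.Unary.Unique.DecPropositional using (unique?)
open import Data.List.Relation.Unary.Unique.Propositional using (Unique)
import Data.List.Relation.Unary.Unique.Propositional.Properties as Unique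
open import Data.Nat.ListAction using (sum)
open import Data.Nat.ListAction.Properties using (sum-↭)
import Data.Nat.Properties as ℕP
open import Data.Nat.Tactic.RingSolver using () renaming (solve-∀ to solveℕ)
open import Data.Product using (_×_; _,_; proj₂)
open import Data.Vec as Vec using (Vec) renaming ([] to []ᵥ; _∷_ to _∷ᵥ_)
import Data.Vec.Properties as Vec
open import Function.Bundles using (mk⇔)
open import Relation.Binary using (tri<; tri≈; tri>)
open import Relation.Binary.Definitions using (DecidableEquality)
open import Relation.Nullary using (Dec; does; yes; no; ¬?)
open import Relation.Nullary.Decidable using (_×-dec_)
open import Relation.Unary using (Decidable)

-- Applying the derivative to one
-- occurrence of a letter ℓ in a monomial x^a y^b z^c w^d multiplies it by
-- the letter's production divided by ℓ; `produce ℓ` is the resulting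
-- change of exponents and `degree ℓ` the number of occurrences of ℓ.
data Letter : Set where
  X Y Z W : Letter

letters : List Letter
letters = X ∷ Y ∷ Z ∷ W ∷ []

degree : Letter → Exponent → ℤ
degree X (a , b , c , d) = a
degree Y (a , b , c , d) = b
degree Z (a , b , c , d) = c
degree W (a , b , c , d) = d

produce : Letter → Exponent → Exponent
produce X (a , b , c , d) = (a , b ℤ.+ 1ℤ , c , d)
produce Y (a , b , c , d) = (a ℤ.+ 1ℤ , b ℤ.- 1ℤ , c ℤ.+ 1ℤ , d)
produce Z (a , b , c , d) = (a , b , c , d ℤ.+ 1ℤ)
produce W (a , b , c , d) = (a ℤ.+ 1ℤ , b , c ℤ.+ 1ℤ , d ℤ.- 1ℤ)

retract : Letter → Exponent → Exponent
retract X (a , b , c , d) = (a , b ℤ.- 1ℤ , c , d)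
retract Y (a , b , c , d) = (a ℤ.- 1ℤ , b ℤ.+ 1ℤ , c ℤ.- 1ℤ , d)
retract Z (a , b , c , d) = (a , b , c , d ℤ.- 1ℤ)
retract W (a , b , c , d) = (a ℤ.- 1ℤ , b , c ℤ.- 1ℤ , d ℤ.+ 1ℤ)

exponent-≡ : ∀ {a a′ b b′ c c′ d d′ : ℤ} → a ≡ a′ → b ≡ b′ → c ≡ c′ → d ≡ d′ →
             _≡_ {A = Exponent} (a , b , c , d) (a′ , b′ , c′ , d′)
exponent-≡ refl refl refl refl = refl

private
  up-down : ∀ i → i ℤ.+ 1ℤ ℤ.- 1ℤ ≡ i
  up-down = solve-∀
  down-up : ∀ i → i ℤ.- 1ℤ ℤ.+ 1ℤ ≡ i
  down-up = solve-∀

produce-retract : ∀ ℓ e → produce ℓ (retract ℓ e) ≡ e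
produce-retract X (a , b , c , d) = exponent-≡ refl (down-up b) refl refl
produce-retract Y (a , b , c , d) = exponent-≡ (down-up a) (up-down b) (down-up c) refl
produce-retract Z (a , b , c , d) = exponent-≡ refl refl refl (down-up d)
produce-retract W (a , b , c , d) = exponent-≡ (down-up a) refl (down-up c) (up-down d)

retract-produce : ∀ ℓ e → retract ℓ (produce ℓ e) ≡ e
retract-produce X (a , b , c , d) = exponent-≡ refl (up-down b) refl refl
retract-produce Y (a , b , c , d) = exponent-≡ (up-down a) (down-up b) (up-down c) refl
retract-produce Z (a , b , c , d) = exponent-≡ refl refl refl (up-down d)
retract-produce W (a , b , c , d) = exponent-≡ (up-down a) refl (up-down c) (down-up d)

Σℤ : {A : Set} → (A → ℤ) → List A → ℤ
Σℤ f [] = 0ℤ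
Σℤ f (a ∷ as) = f a ℤ.+ Σℤ f as

Σℤ-cong : {A : Set} {f g : A → ℤ} (as : List A) → (∀ a → f a ≡ g a) → Σℤ f as ≡ Σℤ g as
Σℤ-cong [] f≡g = refl
Σℤ-cong (a ∷ as) f≡g = cong₂ ℤ._+_ (f≡g a) (Σℤ-cong as f≡g)

Σℤ-+ : {A : Set} (f g : A → ℤ) (as : List A) → Σℤ f as ℤ.+ Σℤ g as ≡ Σℤ (λ a → f a ℤ.+ g a) as
Σℤ-+ f g [] = refl
Σℤ-+ f g (a ∷ as) = trans (interchange (f a) (Σℤ f as) (g a) (Σℤ g as)) (cong (λ s → f a ℤ.+ g a ℤ.+ s) (Σℤ-+ f g as))
  where
    interchange : ∀ i j k l → i ℤ.+ j ℤ.+ (k ℤ.+ l) ≡ i ℤ.+ k ℤ.+ (j ℤ.+ l)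
    interchange = solve-∀

termCoeff : ℤ → Exponent → Exponent → ℤ
termCoeff c f e = if does (f ≟E e) then c else 0ℤ

coeff-++ : ∀ p q e → coeff (p ++ q) e ≡ coeff p e ℤ.+ coeff q e
coeff-++ [] q e = sym (ℤP.+-identityˡ (coeff q e))
coeff-++ ((c , f) ∷ p) q e = trans (cong (λ s → termCoeff c f e ℤ.+ s) (coeff-++ p q e))
  (sym (ℤP.+-assoc (termCoeff c f e) (coeff p e) (coeff q e)))

letter-contribution : ∀ ℓ k f e →
  termCoeff (k ℤ.* degree ℓ f) (produce ℓ f) e ≡ degree ℓ (retract ℓ e) ℤ.* termCoeff k f (retract ℓ e)
letter-contribution ℓ k f e with produce ℓ f ≟E e | f ≟E retract ℓ e
... | yes _  | yes refl = ℤP.*-comm k (degree ℓ (retract ℓ e))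
... | yes p  | no f≢   = ⊥-elim (f≢ (trans (sym (retract-produce ℓ f)) (cong (retract ℓ) p)))
... | no p   | yes refl = ⊥-elim (p (produce-retract ℓ e))
... | no _   | no _    = sym (ℤP.*-zeroʳ (degree ℓ (retract ℓ e)))

coeff-D : ∀ p e → coeff (D p) e ≡ Σℤ (λ ℓ → degree ℓ (retract ℓ e) ℤ.* coeff p (retract ℓ e)) letters
coeff-D [] e = sym (Σℤ-cong letters (λ ℓ → ℤP.*-zeroʳ (degree ℓ (retract ℓ e))))
coeff-D ((k , f) ∷ p) e = begin
  coeff (DTerm (k , f) ++ D p) e
    ≡⟨ coeff-++ (DTerm (k , f)) (D p) e ⟩
  coeff (DTerm (k , f)) e ℤ.+ coeff (D p) e
    ≡⟨ cong₂ ℤ._+_ (Σℤ-cong letters (λ ℓ → letter-contribution ℓ k f e)) (coeff-D p e) ⟩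
  Σℤ (λ ℓ → degree ℓ (retract ℓ e) ℤ.* termCoeff k f (retract ℓ e)) letters
    ℤ.+ Σℤ (λ ℓ → degree ℓ (retract ℓ e) ℤ.* coeff p (retract ℓ e)) letters
    ≡⟨ Σℤ-+ (λ ℓ → degree ℓ (retract ℓ e) ℤ.* termCoeff k f (retract ℓ e))
            (λ ℓ → degree ℓ (retract ℓ e) ℤ.* coeff p (retract ℓ e)) letters ⟩
  Σℤ (λ ℓ → degree ℓ (retract ℓ e) ℤ.* termCoeff k f (retract ℓ e)
            ℤ.+ degree ℓ (retract ℓ e) ℤ.* coeff p (retract ℓ e)) letters
    ≡⟨ Σℤ-cong letters (λ ℓ → sym (ℤP.*-distribˡ-+ (degree ℓ (retract ℓ e)) (termCoeff k f (retract ℓ e)) (coeff p (retract ℓ e)))) ⟩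
  Σℤ (λ ℓ → degree ℓ (retract ℓ e) ℤ.* coeff ((k , f) ∷ p) (retract ℓ e)) letters ∎
  where open ≡-Reasoning

D-cong : ∀ p q → (∀ e → coeff p e ≡ coeff q e) → ∀ e → coeff (D p) e ≡ coeff (D q) e
D-cong p q p≈q e = trans (coeff-D p e)
  (trans (Σℤ-cong letters (λ ℓ → cong (λ c → degree ℓ (retract ℓ e) ℤ.* c) (p≈q (retract ℓ e)))) (sym (coeff-D q e)))

Σ : {A : Set} → (A → ℕ) → List A → ℕ
Σ f xs = sum (map f xs)

Σ-cong : {A : Set} {f g : A → ℕ} {xs : List A} → All (λ x → f x ≡ g x) xs → Σ f xs ≡ Σ g xs
Σ-cong [] = refl
Σ-cong (fx≡gx ∷ f≡g) = cong₂ ℕ._+_ fx≡gx (Σ-cong f≡g)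

Σ-pointwise : {A : Set} {f g : A → ℕ} (xs : List A) → (∀ x → f x ≡ g x) → Σ f xs ≡ Σ g xs
Σ-pointwise [] f≡g = refl
Σ-pointwise (x ∷ xs) f≡g = cong₂ ℕ._+_ (f≡g x) (Σ-pointwise xs f≡g)

Σ-map : {A B : Set} (f : B → ℕ) (g : A → B) (xs : List A) → Σ f (map g xs) ≡ Σ (λ x → f (g x)) xs
Σ-map f g xs = cong sum (sym (map-∘ xs))

Σ-++ : {A : Set} (f : A → ℕ) (xs ys : List A) → Σ f (xs ++ ys) ≡ Σ f xs ℕ.+ Σ f ys
Σ-++ f [] ys = refl
Σ-++ f (x ∷ xs) ys = trans (cong (f x ℕ.+_) (Σ-++ f xs ys)) (sym (ℕP.+-assoc (f x) (Σ f xs) (Σ f ys)))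

Σ-concatMap : {A B : Set} (f : B → ℕ) (g : A → List B) (xs : List A) →
              Σ f (concatMap g xs) ≡ Σ (λ x → Σ f (g x)) xs
Σ-concatMap f g [] = refl
Σ-concatMap f g (x ∷ xs) = trans (Σ-++ f (g x) (concatMap g xs)) (cong (Σ f (g x) ℕ.+_) (Σ-concatMap f g xs))

Σ-↭ : {A : Set} (f : A → ℕ) {xs ys : List A} → xs ↭ ys → Σ f xs ≡ Σ f ys
Σ-↭ f xs↭ys = sum-↭ (↭.map⁺ f xs↭ys)

Σ-+ : {A : Set} (f g : A → ℕ) (xs : List A) → Σ (λ x → f x ℕ.+ g x) xs ≡ Σ f xs ℕ.+ Σ g xs
Σ-+ f g [] = refl
Σ-+ f g (x ∷ xs) = trans (cong (f x ℕ.+ g x ℕ.+_) (Σ-+ f g xs)) (interchange (f x) (g x) (Σ f xs) (Σ g xs))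
  where
    interchange : ∀ a b c d → a ℕ.+ b ℕ.+ (c ℕ.+ d) ≡ a ℕ.+ c ℕ.+ (b ℕ.+ d)
    interchange = solveℕ

Σ-*ˡ : {A : Set} (c : ℕ) (f : A → ℕ) (xs : List A) → Σ (λ x → c ℕ.* f x) xs ≡ c ℕ.* Σ f xs
Σ-*ˡ c f [] = sym (ℕP.*-zeroʳ c)
Σ-*ˡ c f (x ∷ xs) = trans (cong (c ℕ.* f x ℕ.+_) (Σ-*ˡ c f xs)) (sym (ℕP.*-distribˡ-+ c (f x) (Σ f xs)))

Σ-*ʳ : {A : Set} (c : ℕ) (f : A → ℕ) (xs : List A) → Σ (λ x → f x ℕ.* c) xs ≡ Σ f xs ℕ.* c
Σ-*ʳ c f [] = refl
Σ-*ʳ c f (x ∷ xs) = trans (cong (f x ℕ.* c ℕ.+_) (Σ-*ʳ c f xs)) (sym (ℕP.*-distribʳ-+ c (f x) (Σ f xs)))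

Σ-swap : {A B : Set} (F : A → B → ℕ) (xs : List A) (ys : List B) →
         Σ (λ x → Σ (F x) ys) xs ≡ Σ (λ y → Σ (λ x → F x y) xs) ys
Σ-swap F [] ys = sym (Σ-zero ys)
  where
    Σ-zero : {B : Set} (ys : List B) → Σ (λ _ → 0) ys ≡ 0
    Σ-zero [] = refl
    Σ-zero (y ∷ ys) = Σ-zero ys
Σ-swap F (x ∷ xs) ys = trans (cong (Σ (F x) ys ℕ.+_) (Σ-swap F xs ys)) (sym (Σ-+ (F x) (λ y → Σ (λ x → F x y) xs) ys))

All-≢⇒∉ : {A : Set} {k : A} {l : List A} → All (k ≢_) l → k ∉ l
All-≢⇒∉ (k≢x ∷ _) (here k≡x) = k≢x k≡x
All-≢⇒∉ (_ ∷ k∉l) (there k∈l) = All-≢⇒∉ k∉l k∈l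

module _ {A : Set} (_≟_ : DecidableEquality A) (f : A → ℕ) where

  Σ-δ-absent : ∀ {k} {xs : List A} → All (k ≢_) xs → Σ (λ i → b2n (does (k ≟ i)) ℕ.* f i) xs ≡ 0
  Σ-δ-absent [] = refl
  Σ-δ-absent {k} {x ∷ xs} (k≢x ∷ k∉xs) with k ≟ x
  ... | yes k≡x = ⊥-elim (k≢x k≡x)
  ... | no _ = Σ-δ-absent k∉xs

  Σ-δ : ∀ {k} {xs : List A} → k ∈ xs → Unique xs → Σ (λ i → b2n (does (k ≟ i)) ℕ.* f i) xs ≡ f k
  Σ-δ {k} (here refl) (k∉xs ∷ _) with k ≟ k
  ... | yes _ = trans (cong₂ ℕ._+_ (ℕP.+-identityʳ (f k)) (Σ-δ-absent k∉xs)) (ℕP.+-identityʳ (f k))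
  ... | no k≢k = ⊥-elim (k≢k refl)
  Σ-δ {k} {x ∷ xs} (there k∈xs) (x∉xs ∷ u) with k ≟ x
  ... | yes refl = ⊥-elim (All-≢⇒∉ x∉xs k∈xs)
  ... | no _ = Σ-δ k∈xs u

length-filter : {A : Set} {P : A → Set} (P? : Decidable P) (xs : List A) →
                length (filter P? xs) ≡ Σ (λ x → b2n (does (P? x))) xs
length-filter P? [] = refl
length-filter P? (x ∷ xs) with does (P? x)
... | true = cong suc (length-filter P? xs)
... | false = length-filter P? xs

hits : Exponent → Exponent → ℕ
hits f e = b2n (does (f ≟E e))

coeff-terms : {A : Set} (c : A → ℕ) (m : A → Exponent) (xs : List A) (e : Exponent) →
              coeff (map (λ a → (+ c a , m a)) xs) e ≡ + Σ (λ a → c a ℕ.* hits (m a) e) xs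
coeff-terms c m [] e = refl
coeff-terms c m (a ∷ xs) e = cong₂ ℤ._+_ (term (m a ≟E e)) (coeff-terms c m xs e)
  where
    term : (d : Dec (m a ≡ e)) → (if does d then + c a else 0ℤ) ≡ + (c a ℕ.* b2n (does d))
    term (yes _) = cong +_ (sym (ℕP.*-identityʳ (c a)))
    term (no _) = cong +_ (sym (ℕP.*-zeroʳ (c a)))

coeff-concatMap : {A : Set} (F : A → LPoly) (G : A → ℕ) {xs : List A} (e : Exponent) →
                  All (λ a → coeff (F a) e ≡ + G a) xs → coeff (concatMap F xs) e ≡ + Σ G xs
coeff-concatMap F G e [] = refl
coeff-concatMap F G {a ∷ xs} e (Fa≡Ga ∷ F≡G) =
  trans (coeff-++ (F a) (concatMap F xs) e) (cong₂ ℤ._+_ Fa≡Ga (coeff-concatMap F G e F≡G))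

coeff-D-monomial : ∀ E e (n : Letter → ℕ) → (∀ ℓ → + n ℓ ≡ degree ℓ E) →
                   coeff (DTerm (1ℤ , E)) e ≡ + Σ (λ ℓ → n ℓ ℕ.* hits (produce ℓ E) e) letters
coeff-D-monomial E e n n≡degree = Σℤ-cong letters contribution
  where
    contribution : ∀ ℓ → termCoeff (1ℤ ℤ.* degree ℓ E) (produce ℓ E) e ≡ + (n ℓ ℕ.* hits (produce ℓ E) e)
    contribution ℓ with produce ℓ E ≟E e
    ... | yes _ = trans (ℤP.*-identityˡ (degree ℓ E)) (trans (sym (n≡degree ℓ)) (cong +_ (sym (ℕP.*-identityʳ (n ℓ)))))
    ... | no _ = cong +_ (sym (ℕP.*-zeroʳ (n ℓ)))

is : Letter → Letter → ℕ
is X X = 1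
is Y Y = 1
is Z Z = 1
is W W = 1
is _ _ = 0

is-total : ∀ ℓ → Σ (is ℓ) letters ≡ 1
is-total X = refl
is-total Y = refl
is-total Z = refl
is-total W = refl

Σ-classes : {A : Set} (κ : A → Letter) (xs : List A) → Σ (λ ℓ → Σ (λ x → is (κ x) ℓ) xs) letters ≡ length xs
Σ-classes κ xs = begin
  Σ (λ ℓ → Σ (λ x → is (κ x) ℓ) xs) letters   ≡⟨ sym (Σ-swap (λ x ℓ → is (κ x) ℓ) xs letters) ⟩
  Σ (λ x → Σ (is (κ x)) letters) xs           ≡⟨ Σ-pointwise xs (λ x → is-total (κ x)) ⟩
  Σ (λ _ → 1) xs                              ≡⟨ Σ-one xs ⟩
  length xs ∎
  where
    open ≡-Reasoning
    Σ-one : ∀ xs → Σ (λ _ → 1) xs ≡ length xs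
    Σ-one [] = refl
    Σ-one (_ ∷ xs) = cong suc (Σ-one xs)

Σ-by-letter : {A : Set} (κ : A → Letter) (h : Letter → ℕ) (xs : List A) →
              Σ (λ x → h (κ x)) xs ≡ Σ (λ ℓ → Σ (λ x → is (κ x) ℓ) xs ℕ.* h ℓ) letters
Σ-by-letter κ h xs = begin
  Σ (λ x → h (κ x)) xs
    ≡⟨ Σ-pointwise xs (λ x → expand (κ x)) ⟩
  Σ (λ x → Σ (λ ℓ → is (κ x) ℓ ℕ.* h ℓ) letters) xs
    ≡⟨ Σ-swap (λ x ℓ → is (κ x) ℓ ℕ.* h ℓ) xs letters ⟩
  Σ (λ ℓ → Σ (λ x → is (κ x) ℓ ℕ.* h ℓ) xs) letters
    ≡⟨ Σ-pointwise letters (λ ℓ → Σ-*ʳ (h ℓ) (λ x → is (κ x) ℓ) xs) ⟩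
  Σ (λ ℓ → Σ (λ x → is (κ x) ℓ) xs ℕ.* h ℓ) letters ∎
  where
    open ≡-Reasoning
    expand : ∀ ℓ → h ℓ ≡ Σ (λ ℓ′ → is ℓ ℓ′ ℕ.* h ℓ′) letters
    expand X = sym (trans (ℕP.+-identityʳ _) (ℕP.+-identityʳ (h X)))
    expand Y = sym (trans (ℕP.+-identityʳ _) (ℕP.+-identityʳ (h Y)))
    expand Z = sym (trans (ℕP.+-identityʳ _) (ℕP.+-identityʳ (h Z)))
    expand W = sym (trans (ℕP.+-identityʳ _) (ℕP.+-identityʳ (h W)))

-- A window test looks at three consecutive letters a b c of a word.  Both
-- statistics use windows in which the word descends from b to c; they differ
-- in how b is entered from a.
Window : Set
Window = ℕ → ℕ → ℕ → Bool

descentWindow : (ℕ → ℕ → Bool) → Window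
descentWindow enter a b c = enter a b ∧ (c <ᵇ b)

peak doubleDescent : Window
peak = descentWindow (λ a b → a <ᵇ b)
doubleDescent = descentWindow (λ a b → b <ᵇ a)

firstWindow : Window → ℕ → List ℕ → ℕ
firstWindow f a (b ∷ c ∷ _) = b2n (f a b c)
firstWindow f a _ = 0

-- the window centred at u, between the head t of the reversed prefix and
-- the head v of the rest of the word
centredWindow : Window → List ℕ → ℕ → List ℕ → ℕ
centredWindow f rl u [] = 0
centredWindow f [] u (v ∷ _) = 0
centredWindow f (t ∷ _) u (v ∷ _) = b2n (f t u v)

centredWindow-start : ∀ f u L → centredWindow f [] u L ≡ 0
centredWindow-start f u [] = refl
centredWindow-start f u (_ ∷ _) = refl

windows : Window → List ℕ → ℕ
windows f [] = 0
windows f (a ∷ l) = firstWindow f a l ℕ.+ windows f l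

interiorPeaks≡windows : ∀ l → interiorPeaks l ≡ windows peak l
interiorPeaks≡windows [] = refl
interiorPeaks≡windows (a ∷ []) = refl
interiorPeaks≡windows (a ∷ b ∷ []) = refl
interiorPeaks≡windows (a ∷ b ∷ c ∷ r) = cong (b2n (peak a b c) ℕ.+_) (interiorPeaks≡windows (b ∷ c ∷ r))

properDoubleDescents≡windows : ∀ l → properDoubleDescents l ≡ windows doubleDescent l
properDoubleDescents≡windows [] = refl
properDoubleDescents≡windows (a ∷ []) = refl
properDoubleDescents≡windows (a ∷ b ∷ []) = refl
properDoubleDescents≡windows (a ∷ b ∷ c ∷ r) =
  cong (b2n (doubleDescent a b c) ℕ.+_) (properDoubleDescents≡windows (b ∷ c ∷ r))

b2n≤1 : ∀ x → b2n x ≤ 1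
b2n≤1 true = ℕP.≤-refl
b2n≤1 false = z≤n

windows-≤ : ∀ f a b r → windows f (a ∷ b ∷ r) ≤ length r
windows-≤ f a b [] = z≤n
windows-≤ f a b (c ∷ r) = ℕP.+-mono-≤ (b2n≤1 (f a b c)) (windows-≤ f b c r)

first≡centred : ∀ f t rl u L → firstWindow f t (u ∷ L) ≡ centredWindow f (t ∷ rl) u L
first≡centred f t rl u [] = refl
first≡centred f t rl u (_ ∷ _) = refl

windows-split : ∀ f rl u L →
  windows f (reverseAcc (u ∷ L) rl) ≡ windows f (reverseAcc (u ∷ []) rl) ℕ.+ centredWindow f rl u L ℕ.+ windows f (u ∷ L)
windows-split f [] u [] = refl
windows-split f [] u (_ ∷ _) = refl
windows-split f (t ∷ rl) u L = begin
  windows f (reverseAcc (t ∷ u ∷ L) rl)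
    ≡⟨ windows-split f rl t (u ∷ L) ⟩
  A ℕ.+ centredWindow f rl t (u ∷ L) ℕ.+ (firstWindow f t (u ∷ L) ℕ.+ windows f (u ∷ L))
    ≡⟨ cong₂ (λ c c′ → A ℕ.+ c ℕ.+ (c′ ℕ.+ windows f (u ∷ L))) (centred-head rl L) (first≡centred f t rl u L) ⟩
  A ℕ.+ centredWindow f rl t (u ∷ []) ℕ.+ (centredWindow f (t ∷ rl) u L ℕ.+ windows f (u ∷ L))
    ≡⟨ regroup A (centredWindow f rl t (u ∷ [])) (centredWindow f (t ∷ rl) u L) (windows f (u ∷ L)) ⟩
  A ℕ.+ centredWindow f rl t (u ∷ []) ℕ.+ 0 ℕ.+ centredWindow f (t ∷ rl) u L ℕ.+ windows f (u ∷ L)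
    ≡⟨ cong (λ s → s ℕ.+ centredWindow f (t ∷ rl) u L ℕ.+ windows f (u ∷ L)) (sym (windows-split f rl t (u ∷ []))) ⟩
  windows f (reverseAcc (t ∷ u ∷ []) rl) ℕ.+ centredWindow f (t ∷ rl) u L ℕ.+ windows f (u ∷ L) ∎
  where
    open ≡-Reasoning
    A : ℕ
    A = windows f (reverseAcc (t ∷ []) rl)
    centred-head : ∀ rl L → centredWindow f rl t (u ∷ L) ≡ centredWindow f rl t (u ∷ [])
    centred-head [] L = refl
    centred-head (_ ∷ _) L = refl
    regroup : ∀ a b c d → a ℕ.+ b ℕ.+ (c ℕ.+ d) ≡ a ℕ.+ b ℕ.+ 0 ℕ.+ c ℕ.+ d
    regroup = solveℕ

-- Inserting m between u and v replaces the windows centred at u and v by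
-- the windows centred at u, m and v.
windows-insert : ∀ f rl u m v V →
  centredWindow f rl u (v ∷ V) ℕ.+ firstWindow f u (v ∷ V) ℕ.+ windows f (reverseAcc (u ∷ m ∷ v ∷ V) rl)
  ≡ centredWindow f rl u (m ∷ []) ℕ.+ b2n (f u m v) ℕ.+ firstWindow f m (v ∷ V) ℕ.+ windows f (reverseAcc (u ∷ v ∷ V) rl)
windows-insert f rl u m v V = begin
  c₀ ℕ.+ w₀ ℕ.+ windows f (reverseAcc (u ∷ m ∷ v ∷ V) rl)
    ≡⟨ cong (c₀ ℕ.+ w₀ ℕ.+_) (windows-split f rl u (m ∷ v ∷ V)) ⟩
  c₀ ℕ.+ w₀ ℕ.+ (A ℕ.+ c₁ ℕ.+ (b2n (f u m v) ℕ.+ (w₁ ℕ.+ windows f (v ∷ V))))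
    ≡⟨ rearrange c₀ w₀ A c₁ (b2n (f u m v)) w₁ (windows f (v ∷ V)) ⟩
  c₁ ℕ.+ b2n (f u m v) ℕ.+ w₁ ℕ.+ (A ℕ.+ c₀ ℕ.+ (w₀ ℕ.+ windows f (v ∷ V)))
    ≡⟨ cong₂ (λ c s → c ℕ.+ b2n (f u m v) ℕ.+ w₁ ℕ.+ s) (centred-head rl) (sym (windows-split f rl u (v ∷ V))) ⟩
  centredWindow f rl u (m ∷ []) ℕ.+ b2n (f u m v) ℕ.+ w₁ ℕ.+ windows f (reverseAcc (u ∷ v ∷ V) rl) ∎
  where
    open ≡-Reasoning
    A c₀ c₁ w₀ w₁ : ℕ
    A = windows f (reverseAcc (u ∷ []) rl)
    c₀ = centredWindow f rl u (v ∷ V)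
    c₁ = centredWindow f rl u (m ∷ v ∷ V)
    w₀ = firstWindow f u (v ∷ V)
    w₁ = firstWindow f m (v ∷ V)
    centred-head : ∀ rl → centredWindow f rl u (m ∷ v ∷ V) ≡ centredWindow f rl u (m ∷ [])
    centred-head [] = refl
    centred-head (_ ∷ _) = refl
    rearrange : ∀ c₀ w₀ a c₁ x w₁ r → c₀ ℕ.+ w₀ ℕ.+ (a ℕ.+ c₁ ℕ.+ (x ℕ.+ (w₁ ℕ.+ r)))
                                    ≡ c₁ ℕ.+ x ℕ.+ w₁ ℕ.+ (a ℕ.+ c₀ ℕ.+ (w₀ ℕ.+ r))
    rearrange = solveℕ

<ᵇ-true : ∀ {m n} → m < n → (m <ᵇ n) ≡ true
<ᵇ-true (s≤s z≤n) = refl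
<ᵇ-true (s≤s (s≤s m<n)) = <ᵇ-true (s≤s m<n)

<ᵇ-false : ∀ {m n} → n ≤ m → (m <ᵇ n) ≡ false
<ᵇ-false z≤n = refl
<ᵇ-false (s≤s n≤m) = <ᵇ-false n≤m

<ᵇ-flip : ∀ {u v} → u ≢ v → (v <ᵇ u) ≡ not (u <ᵇ v)
<ᵇ-flip {u} {v} u≢v with ℕP.<-cmp u v
... | tri< u<v _ _ rewrite <ᵇ-true u<v | <ᵇ-false (ℕP.<⇒≤ u<v) = refl
... | tri≈ _ u≡v _ = ⊥-elim (u≢v u≡v)
... | tri> _ _ v<u rewrite <ᵇ-true v<u | <ᵇ-false (ℕP.<⇒≤ v<u) = refl

<ᵇ-asym : ∀ u t → (u <ᵇ t) ∧ (t <ᵇ u) ≡ false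
<ᵇ-asym zero zero = refl
<ᵇ-asym zero (suc t) = refl
<ᵇ-asym (suc u) zero = refl
<ᵇ-asym (suc u) (suc t) = <ᵇ-asym u t

descentWindow-rise : ∀ enter a {b c} → b ≤ c → descentWindow enter a b c ≡ false
descentWindow-rise enter a {b} b≤c = trans (cong (enter a b ∧_) (<ᵇ-false b≤c)) (∧-zeroʳ (enter a b))

-- The extension of a word: its letters shifted up by one, between the
-- sentinels 0 (below everything) and B (above everything).
extend : ℕ → List ℕ → List ℕ
extend B l = 0 ∷ (map suc l ++ B ∷ [])

windows-shift : ∀ enter → (∀ a b → enter (suc a) (suc b) ≡ enter a b) → ∀ {B} a l →
                All (λ x → suc x < B) (a ∷ l) →
                windows (descentWindow enter) (map suc (a ∷ l) ++ B ∷ []) ≡ windows (descentWindow enter) (a ∷ l)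
windows-shift enter shift a [] _ = refl
windows-shift enter shift a (b ∷ l) (_ ∷ below) = cong₂ ℕ._+_ (first-shift l below) (windows-shift enter shift b l below)
  where
    first-shift : ∀ l → All (λ x → suc x < _) (b ∷ l) →
                  firstWindow (descentWindow enter) (suc a) (map suc (b ∷ l) ++ _ ∷ []) ≡ firstWindow (descentWindow enter) a (b ∷ l)
    first-shift [] (sb<B ∷ _) = cong b2n (descentWindow-rise enter (suc a) (ℕP.<⇒≤ sb<B))
    first-shift (c ∷ _) _ = cong (λ x → b2n (x ∧ (c <ᵇ b))) (shift a b)

-- The statistics of a word with letters below B - 1 are window counts of its
-- extension: the bottom sentinel turns a first descent into a peak, and no
-- window ends in the top sentinel.
exteriorPeaks≡windows : ∀ {B} l → All (λ x → suc x < B) l → exteriorPeaks l ≡ windows peak (extend B l)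
exteriorPeaks≡windows [] _ = refl
exteriorPeaks≡windows (a ∷ []) (sa<B ∷ _) = sym (cong (λ x → b2n x ℕ.+ 0) (<ᵇ-false (ℕP.<⇒≤ sa<B)))
exteriorPeaks≡windows (a ∷ b ∷ r) below =
  cong (b2n (b <ᵇ a) ℕ.+_) (trans (interiorPeaks≡windows (a ∷ b ∷ r)) (sym (windows-shift _<ᵇ_ (λ _ _ → refl) a (b ∷ r) below)))

properDoubleDescents≡windows-extend : ∀ {B} l → All (λ x → suc x < B) l →
  properDoubleDescents l ≡ windows doubleDescent (extend B l)
properDoubleDescents≡windows-extend [] _ = refl
properDoubleDescents≡windows-extend (a ∷ []) below = refl
properDoubleDescents≡windows-extend (a ∷ b ∷ l) below =
  trans (properDoubleDescents≡windows (a ∷ b ∷ l)) (sym (windows-shift (λ a b → b <ᵇ a) (λ _ _ → refl) a (b ∷ l) below))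

-- A gap of a word, seen from inside: the letters `left` and `right` on
-- either side of it, the reversed prefix `before` the left letter and the
-- suffix `after` the right one.
record Gap : Set where
  constructor gap
  field
    before : List ℕ
    left right : ℕ
    after : List ℕ

around : Gap → List ℕ
around (gap rl u v V) = reverseAcc (u ∷ v ∷ V) rl

fill : ℕ → Gap → List ℕ
fill m (gap rl u v V) = reverseAcc (u ∷ m ∷ v ∷ V) rl

gaps : List ℕ → ℕ → List ℕ → List Gap
gaps rl u [] = []
gaps rl u (v ∷ V) = gap rl u v V ∷ gaps (u ∷ rl) v V

around-gaps : ∀ rl u L → All (λ g → around g ≡ reverseAcc (u ∷ L) rl) (gaps rl u L)
around-gaps rl u [] = []
around-gaps rl u (v ∷ V) = refl ∷ around-gaps (u ∷ rl) v V

Σ-gaps-first : ∀ f rl u L → Σ (λ g → firstWindow f (Gap.left g) (Gap.right g ∷ Gap.after g)) (gaps rl u L) ≡ windows f (u ∷ L)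
Σ-gaps-first f rl u [] = refl
Σ-gaps-first f rl u (v ∷ V) = cong (firstWindow f u (v ∷ V) ℕ.+_) (Σ-gaps-first f (u ∷ rl) v V)

Σ-gaps-centred : ∀ f rl u L → Σ (λ g → centredWindow f (Gap.before g) (Gap.left g) (Gap.right g ∷ Gap.after g)) (gaps rl u L)
                               ≡ centredWindow f rl u L ℕ.+ windows f (u ∷ L)
Σ-gaps-centred f rl u [] = refl
Σ-gaps-centred f rl u (v ∷ V) = begin
  centredWindow f rl u (v ∷ V) ℕ.+ Σ (λ g → centredWindow f (Gap.before g) (Gap.left g) (Gap.right g ∷ Gap.after g)) (gaps (u ∷ rl) v V)
    ≡⟨ cong (centredWindow f rl u (v ∷ V) ℕ.+_) (Σ-gaps-centred f (u ∷ rl) v V) ⟩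
  centredWindow f rl u (v ∷ V) ℕ.+ (centredWindow f (u ∷ rl) v V ℕ.+ windows f (v ∷ V))
    ≡⟨ cong (λ c → centredWindow f rl u (v ∷ V) ℕ.+ (c ℕ.+ windows f (v ∷ V))) (sym (first≡centred f u rl v V)) ⟩
  centredWindow f rl u (v ∷ V) ℕ.+ windows f (u ∷ v ∷ V) ∎
  where open ≡-Reasoning

isLast : List ℕ → ℕ
isLast [] = 1
isLast (_ ∷ _) = 0

Σ-gaps-last : ∀ rl u L top → Σ (λ g → isLast (Gap.after g)) (gaps rl u (L ++ top ∷ [])) ≡ 1
Σ-gaps-last rl u [] top = refl
Σ-gaps-last rl u (v ∷ L) top =
  trans (cong (ℕ._+ Σ (λ g → isLast (Gap.after g)) (gaps (u ∷ rl) v (L ++ top ∷ []))) (not-last L)) (Σ-gaps-last (u ∷ rl) v L top)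
  where
    not-last : ∀ L → isLast (L ++ top ∷ []) ≡ 0
    not-last [] = refl
    not-last (_ ∷ _) = refl

length-gaps : ∀ rl u L → length (gaps rl u L) ≡ length L
length-gaps rl u [] = refl
length-gaps rl u (v ∷ V) = cong suc (length-gaps (u ∷ rl) v V)

fromAbove fromBelow : List ℕ → ℕ → Bool
fromAbove [] u = false
fromAbove (t ∷ _) u = u <ᵇ t
fromBelow [] u = false
fromBelow (t ∷ _) u = t <ᵇ u

entry-asym : ∀ rl u → fromAbove rl u ∧ fromBelow rl u ≡ false
entry-asym [] u = refl
entry-asym (t ∷ _) u = <ᵇ-asym u t

-- The kind of a gap u|v followed by s, for a gap that is not the last one:
-- X if v is a peak (u < v > s), Y if u is the middle of a double descent
-- (t > u > v), Z if u is a peak (t < u > v), and W otherwise.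
classify : (rise fall above below : Bool) → Letter
classify true true _ _ = X
classify true false _ _ = W
classify false _ true _ = Y
classify false _ false true = Z
classify false _ false false = W

-- The last gap, in front of the top sentinel, is of kind Z.
kind : Gap → Letter
kind (gap rl u v []) = Z
kind (gap rl u v (s ∷ _)) = classify (u <ᵇ v) (s <ᵇ v) (fromAbove rl u) (fromBelow rl u)

centred-peak : ∀ rl u v V → centredWindow peak rl u (v ∷ V) ≡ b2n (fromBelow rl u ∧ (v <ᵇ u))
centred-peak [] u v V = refl
centred-peak (t ∷ _) u v V = refl

centred-doubleDescent : ∀ rl u v V → centredWindow doubleDescent rl u (v ∷ V) ≡ b2n (fromAbove rl u ∧ (v <ᵇ u))
centred-doubleDescent [] u v V = refl
centred-doubleDescent (t ∷ _) u v V = refl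

Placed : ℕ → ℕ → List ℕ → Set
Placed m v [] = m < v
Placed m v (_ ∷ _) = v < m

record Admissible (m : ℕ) (g : Gap) : Set where
  constructor admissible
  field
    left<m : Gap.left g < m
    left≢right : Gap.left g ≢ Gap.right g
    placed : Placed m (Gap.right g) (Gap.after g)

centred-rise : ∀ enter rl {u v} V → u ≤ v → centredWindow (descentWindow enter) rl u (v ∷ V) ≡ 0
centred-rise enter [] V u≤v = refl
centred-rise enter (t ∷ _) V u≤v = cong b2n (descentWindow-rise enter t u≤v)

kind-X : ∀ g → is (kind g) X ≡ firstWindow peak (Gap.left g) (Gap.right g ∷ Gap.after g)
kind-X (gap rl u v []) = refl
kind-X (gap rl u v (s ∷ V)) = classify-X (u <ᵇ v) (s <ᵇ v) (fromAbove rl u) (fromBelow rl u)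
  where
    classify-X : ∀ rise fall above below → is (classify rise fall above below) X ≡ b2n (rise ∧ fall)
    classify-X true true _ _ = refl
    classify-X true false _ _ = refl
    classify-X false _ true _ = refl
    classify-X false _ false true = refl
    classify-X false _ false false = refl

kind-Y : ∀ {m} g → Admissible m g → is (kind g) Y ≡ centredWindow doubleDescent (Gap.before g) (Gap.left g) (Gap.right g ∷ Gap.after g)
kind-Y (gap rl u v []) (admissible u<m _ m<v) = sym (centred-rise _ rl [] (ℕP.<⇒≤ (ℕP.<-trans u<m m<v)))
kind-Y (gap rl u v (s ∷ V)) (admissible _ u≢v _) = begin
  is (classify (u <ᵇ v) (s <ᵇ v) (fromAbove rl u) (fromBelow rl u)) Y
    ≡⟨ classify-Y (u <ᵇ v) (s <ᵇ v) (fromAbove rl u) (fromBelow rl u) ⟩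
  b2n (fromAbove rl u ∧ not (u <ᵇ v))
    ≡⟨ cong (λ x → b2n (fromAbove rl u ∧ x)) (sym (<ᵇ-flip u≢v)) ⟩
  b2n (fromAbove rl u ∧ (v <ᵇ u))
    ≡⟨ sym (centred-doubleDescent rl u v (s ∷ V)) ⟩
  centredWindow doubleDescent rl u (v ∷ s ∷ V) ∎
  where
    open ≡-Reasoning
    classify-Y : ∀ rise fall above below → is (classify rise fall above below) Y ≡ b2n (above ∧ not rise)
    classify-Y true true above _ = sym (cong b2n (∧-zeroʳ above))
    classify-Y true false above _ = sym (cong b2n (∧-zeroʳ above))
    classify-Y false _ true _ = refl
    classify-Y false _ false true = refl
    classify-Y false _ false false = refl

kind-Z : ∀ {m} g → Admissible m g →
         is (kind g) Z ≡ centredWindow peak (Gap.before g) (Gap.left g) (Gap.right g ∷ Gap.after g) ℕ.+ isLast (Gap.after g)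
kind-Z (gap rl u v []) (admissible u<m _ m<v) = sym (cong (ℕ._+ 1) (centred-rise _ rl [] (ℕP.<⇒≤ (ℕP.<-trans u<m m<v))))
kind-Z (gap rl u v (s ∷ V)) (admissible _ u≢v _) = begin
  is (classify (u <ᵇ v) (s <ᵇ v) (fromAbove rl u) (fromBelow rl u)) Z
    ≡⟨ classify-Z (u <ᵇ v) (s <ᵇ v) (fromAbove rl u) (fromBelow rl u) (entry-asym rl u) ⟩
  b2n (fromBelow rl u ∧ not (u <ᵇ v)) ℕ.+ 0
    ≡⟨ cong (λ x → b2n (fromBelow rl u ∧ x) ℕ.+ 0) (sym (<ᵇ-flip u≢v)) ⟩
  b2n (fromBelow rl u ∧ (v <ᵇ u)) ℕ.+ 0
    ≡⟨ cong (ℕ._+ 0) (sym (centred-peak rl u v (s ∷ V))) ⟩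
  centredWindow peak rl u (v ∷ s ∷ V) ℕ.+ 0 ∎
  where
    open ≡-Reasoning
    classify-Z : ∀ rise fall above below → above ∧ below ≡ false →
                 is (classify rise fall above below) Z ≡ b2n (below ∧ not rise) ℕ.+ 0
    classify-Z true true _ below _ = sym (cong (λ x → b2n x ℕ.+ 0) (∧-zeroʳ below))
    classify-Z true false _ below _ = sym (cong (λ x → b2n x ℕ.+ 0) (∧-zeroʳ below))
    classify-Z false _ true true ()
    classify-Z false _ true false _ = refl
    classify-Z false _ false true _ = refl
    classify-Z false _ false false _ = refl

count-X : ∀ rl u L → Σ (λ g → is (kind g) X) (gaps rl u L) ≡ windows peak (u ∷ L)
count-X rl u L = trans (Σ-pointwise (gaps rl u L) kind-X) (Σ-gaps-first peak rl u L)

count-Y : ∀ {m} rl u L → All (Admissible m) (gaps rl u L) →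
          Σ (λ g → is (kind g) Y) (gaps rl u L) ≡ centredWindow doubleDescent rl u L ℕ.+ windows doubleDescent (u ∷ L)
count-Y rl u L adm = trans (Σ-cong (All.map (λ {g} → kind-Y g) adm)) (Σ-gaps-centred doubleDescent rl u L)

count-Z : ∀ {m} rl u L top → All (Admissible m) (gaps rl u (L ++ top ∷ [])) →
          Σ (λ g → is (kind g) Z) (gaps rl u (L ++ top ∷ []))
          ≡ centredWindow peak rl u (L ++ top ∷ []) ℕ.+ windows peak (u ∷ L ++ top ∷ []) ℕ.+ 1
count-Z rl u L top adm = begin
  Σ (λ g → is (kind g) Z) G                   ≡⟨ Σ-cong (All.map (λ {g} → kind-Z g) adm) ⟩
  Σ (λ g → centred g ℕ.+ isLast (Gap.after g)) G
                                              ≡⟨ Σ-+ centred (λ g → isLast (Gap.after g)) G ⟩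
  Σ centred G ℕ.+ Σ (λ g → isLast (Gap.after g)) G
                                              ≡⟨ cong₂ ℕ._+_ (Σ-gaps-centred peak rl u (L ++ top ∷ [])) (Σ-gaps-last rl u L top) ⟩
  centredWindow peak rl u (L ++ top ∷ []) ℕ.+ windows peak (u ∷ L ++ top ∷ []) ℕ.+ 1 ∎
  where
    open ≡-Reasoning
    G : List Gap
    G = gaps rl u (L ++ top ∷ [])
    centred : Gap → ℕ
    centred g = centredWindow peak (Gap.before g) (Gap.left g) (Gap.right g ∷ Gap.after g)

-- How the numbers p of peaks and d of double descents change when a letter
-- larger than all others is inserted into a gap of kind ℓ.  This mirrors
-- the grammar: x → xy adds a y, y → xz trades a y for an x (and a z),
-- z → zw changes neither, and w → xz adds an x (and a z).
Step : Letter → (p d p′ d′ : ℕ) → Set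
Step X p d p′ d′ = p′ ≡ p × d′ ≡ suc d
Step Y p d p′ d′ = p′ ≡ suc p × d ≡ suc d′
Step Z p d p′ d′ = p′ ≡ p × d′ ≡ d
Step W p d p′ d′ = p′ ≡ suc p × d′ ≡ d

windows-insert-evaluated : ∀ f rl u m v V {D C} →
  centredWindow f rl u (v ∷ V) ℕ.+ firstWindow f u (v ∷ V) ≡ D →
  centredWindow f rl u (m ∷ []) ℕ.+ b2n (f u m v) ℕ.+ firstWindow f m (v ∷ V) ≡ C →
  D ℕ.+ windows f (fill m (gap rl u v V)) ≡ C ℕ.+ windows f (around (gap rl u v V))
windows-insert-evaluated f rl u m v V refl refl = windows-insert f rl u m v V

-- For a gap that is not the last one, the destroyed windows are the peak or
-- double descent centred at u and the one starting at u, and the created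
-- windows are the peak at m and, for double descents, m > v > s.
classify-step : ∀ above below rise fall → above ∧ below ≡ false → ∀ {p d p′ d′} →
  b2n (below ∧ not rise) ℕ.+ b2n (rise ∧ fall) ℕ.+ p′ ≡ 1 ℕ.+ p →
  b2n (above ∧ not rise) ℕ.+ b2n (not rise ∧ fall) ℕ.+ d′ ≡ b2n fall ℕ.+ d →
  Step (classify rise fall above below) p d p′ d′
classify-step true true _ _ ()
classify-step false false true true _ p′ d′ = ℕP.suc-injective p′ , d′
classify-step false false true false _ p′ d′ = p′ , d′
classify-step false false false true _ p′ d′ = p′ , ℕP.suc-injective d′
classify-step false false false false _ p′ d′ = p′ , d′
classify-step false true true true _ p′ d′ = ℕP.suc-injective p′ , d′
classify-step false true true false _ p′ d′ = p′ , d′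
classify-step false true false true _ p′ d′ = ℕP.suc-injective p′ , ℕP.suc-injective d′
classify-step false true false false _ p′ d′ = ℕP.suc-injective p′ , d′
classify-step true false true true _ p′ d′ = ℕP.suc-injective p′ , d′
classify-step true false true false _ p′ d′ = p′ , d′
classify-step true false false true _ p′ d′ = p′ , sym (ℕP.suc-injective d′)
classify-step true false false false _ p′ d′ = p′ , sym d′

cong₃ : {A B C D : Set} (f : A → B → C → D) {a a′ : A} {b b′ : B} {c c′ : C} →
        a ≡ a′ → b ≡ b′ → c ≡ c′ → f a b c ≡ f a′ b′ c′
cong₃ f refl refl refl = refl

gap-step : ∀ {m} g → Admissible m g →
  Step (kind g) (windows peak (around g)) (windows doubleDescent (around g))
                (windows peak (fill m g)) (windows doubleDescent (fill m g))
gap-step {m} (gap rl u v []) (admissible u<m _ m<v) = last-gap peak-entry , last-gap dd-entry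
  where
    peak-entry dd-entry : ℕ → ℕ → Bool
    peak-entry a b = a <ᵇ b
    dd-entry a b = b <ᵇ a
    -- in front of the top sentinel nothing is destroyed or created
    last-gap : ∀ enter → windows (descentWindow enter) (fill m (gap rl u v [])) ≡ windows (descentWindow enter) (around (gap rl u v []))
    last-gap enter = windows-insert-evaluated (descentWindow enter) rl u m v []
      (cong (ℕ._+ 0) (centred-rise enter rl [] (ℕP.<⇒≤ (ℕP.<-trans u<m m<v))))
      (cong₂ (λ c w → c ℕ.+ b2n w ℕ.+ 0) (centred-rise enter rl [] (ℕP.<⇒≤ u<m)) (descentWindow-rise enter u (ℕP.<⇒≤ m<v)))
gap-step {m} (gap rl u v (s ∷ V)) (admissible u<m u≢v v<m) =
  classify-step (fromAbove rl u) (fromBelow rl u) (u <ᵇ v) (s <ᵇ v) (entry-asym rl u) peaks doubleDescents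
  where
    v<ᵇu : (v <ᵇ u) ≡ not (u <ᵇ v)
    v<ᵇu = <ᵇ-flip u≢v
    peaks : b2n (fromBelow rl u ∧ not (u <ᵇ v)) ℕ.+ b2n ((u <ᵇ v) ∧ (s <ᵇ v)) ℕ.+ windows peak (fill m (gap rl u v (s ∷ V)))
            ≡ 1 ℕ.+ windows peak (around (gap rl u v (s ∷ V)))
    peaks = windows-insert-evaluated peak rl u m v (s ∷ V)
      (cong (ℕ._+ b2n ((u <ᵇ v) ∧ (s <ᵇ v))) (trans (centred-peak rl u v (s ∷ V)) (cong (λ x → b2n (fromBelow rl u ∧ x)) v<ᵇu)))
      (cong₃ (λ c b b′ → c ℕ.+ b2n b ℕ.+ b2n (b′ ∧ (s <ᵇ v)))
             (centred-rise _ rl [] (ℕP.<⇒≤ u<m)) (cong₂ _∧_ (<ᵇ-true u<m) (<ᵇ-true v<m)) (<ᵇ-false (ℕP.<⇒≤ v<m)))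
    doubleDescents : b2n (fromAbove rl u ∧ not (u <ᵇ v)) ℕ.+ b2n (not (u <ᵇ v) ∧ (s <ᵇ v)) ℕ.+ windows doubleDescent (fill m (gap rl u v (s ∷ V)))
                     ≡ b2n (s <ᵇ v) ℕ.+ windows doubleDescent (around (gap rl u v (s ∷ V)))
    doubleDescents = windows-insert-evaluated doubleDescent rl u m v (s ∷ V)
      (cong₂ ℕ._+_ (trans (centred-doubleDescent rl u v (s ∷ V)) (cong (λ x → b2n (fromAbove rl u ∧ x)) v<ᵇu))
                   (cong (λ x → b2n (x ∧ (s <ᵇ v))) v<ᵇu))
      (cong₃ (λ c b b′ → c ℕ.+ b2n b ℕ.+ b2n (b′ ∧ (s <ᵇ v)))
             (centred-rise _ rl [] (ℕP.<⇒≤ u<m)) (cong (_∧ (v <ᵇ m)) (<ᵇ-false (ℕP.<⇒≤ u<m))) (<ᵇ-true v<m))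

-- The monomial x^p y^d z^(p+1) w^(k-2p-d), for words of length k with p
-- exterior peaks and d proper double descents; written as in the
-- definition of P.
monomialℤ : ℤ → ℤ → ℤ → Exponent
monomialℤ k p d = (p , d , p ℤ.+ 1ℤ , k ℤ.- (+ 2 ℤ.* p) ℤ.- d)

monomial : ℕ → ℕ → ℕ → Exponent
monomial k p d = monomialℤ (+ k) (+ p) (+ d)

+-suc : ∀ n → + suc n ≡ + n ℤ.+ 1ℤ
+-suc n = cong +_ (ℕP.+-comm 1 n)

monomial-step : ∀ ℓ k {p d p′ d′} → Step ℓ p d p′ d′ → monomial (suc k) p′ d′ ≡ produce ℓ (monomial k p d)
monomial-step X k {p} {d} (refl , refl) =
  trans (cong₃ monomialℤ (+-suc k) refl (+-suc d)) (exponent-≡ refl refl refl (w-exponent (+ k) (+ p) (+ d)))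
  where
    w-exponent : ∀ k p d → k ℤ.+ 1ℤ ℤ.- (+ 2 ℤ.* p) ℤ.- (d ℤ.+ 1ℤ) ≡ k ℤ.- (+ 2 ℤ.* p) ℤ.- d
    w-exponent = solve-∀
monomial-step Y k {p} {d′ = d′} (refl , refl) =
  trans (cong₃ monomialℤ (+-suc k) (+-suc p) refl)
        (exponent-≡ refl (trans (y-exponent (+ d′)) (cong (ℤ._- 1ℤ) (sym (+-suc d′)))) refl
                    (trans (w-exponent (+ k) (+ p) (+ d′)) (cong (λ d → + k ℤ.- (+ 2 ℤ.* + p) ℤ.- d) (sym (+-suc d′)))))
  where
    y-exponent : ∀ d → d ≡ d ℤ.+ 1ℤ ℤ.- 1ℤ
    y-exponent = solve-∀
    w-exponent : ∀ k p d → k ℤ.+ 1ℤ ℤ.- (+ 2 ℤ.* (p ℤ.+ 1ℤ)) ℤ.- d ≡ k ℤ.- (+ 2 ℤ.* p) ℤ.- (d ℤ.+ 1ℤ)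
    w-exponent = solve-∀
monomial-step Z k {p} {d} (refl , refl) =
  trans (cong₃ monomialℤ (+-suc k) refl refl) (exponent-≡ refl refl refl (w-exponent (+ k) (+ p) (+ d)))
  where
    w-exponent : ∀ k p d → k ℤ.+ 1ℤ ℤ.- (+ 2 ℤ.* p) ℤ.- d ≡ k ℤ.- (+ 2 ℤ.* p) ℤ.- d ℤ.+ 1ℤ
    w-exponent = solve-∀
monomial-step W k {p} {d} (refl , refl) =
  trans (cong₃ monomialℤ (+-suc k) (+-suc p) refl) (exponent-≡ refl refl refl (w-exponent (+ k) (+ p) (+ d)))
  where
    w-exponent : ∀ k p d → k ℤ.+ 1ℤ ℤ.- (+ 2 ℤ.* (p ℤ.+ 1ℤ)) ℤ.- d ≡ k ℤ.- (+ 2 ℤ.* p) ℤ.- d ℤ.- 1ℤ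
    w-exponent = solve-∀

record IsPerm (n : ℕ) (w : List ℕ) : Set where
  constructor isPerm
  field
    distinct : Unique w
    bounded : All (_< n) w
    size : length w ≡ n

monomialOf : ℕ → List ℕ → Exponent
monomialOf k l = monomial k (exteriorPeaks l) (properDoubleDescents l)

windowMonomial : ℕ → List ℕ → Exponent
windowMonomial k L = monomial k (windows peak L) (windows doubleDescent L)

monomialOf≡windowMonomial : ∀ {B} k l → All (λ x → suc x < B) l → monomialOf k l ≡ windowMonomial k (extend B l)
monomialOf≡windowMonomial k l below =
  cong₂ (monomial k) (exteriorPeaks≡windows l below) (properDoubleDescents≡windows-extend l below)

insertions : ℕ → List ℕ → List (List ℕ)
insertions M [] = (M ∷ []) ∷ []
insertions M (a ∷ w) = (M ∷ a ∷ w) ∷ map (a ∷_) (insertions M w)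

insertions-All : ∀ {P : ℕ → Set} M w → P M → All P w → All (All P) (insertions M w)
insertions-All M [] pM [] = (pM ∷ []) ∷ []
insertions-All M (a ∷ w) pM (pa ∷ pw) = (pM ∷ pa ∷ pw) ∷ All.map⁺ (All.map (pa ∷_) (insertions-All M w pM pw))

-- Inserting M and extending is filling a gap of the extension with M + 1.
insertions-gaps : ∀ B M rl u w → map (λ l → reverseAcc (u ∷ map suc l ++ B ∷ []) rl) (insertions M w)
                                 ≡ map (fill (suc M)) (gaps rl u (map suc w ++ B ∷ []))
insertions-gaps B M rl u [] = refl
insertions-gaps B M rl u (a ∷ w) =
  cong (reverseAcc (u ∷ suc M ∷ suc a ∷ map suc w ++ B ∷ []) rl ∷_)
       (trans (sym (map-∘ (insertions M w))) (insertions-gaps B M (u ∷ rl) (suc a) w))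

gaps-admissible : ∀ {m top} rl u L → All (_< m) (u ∷ L) → m < top → Unique (u ∷ L) →
                  All (Admissible m) (gaps rl u (L ++ top ∷ []))
gaps-admissible rl u [] (u<m ∷ []) m<top _ =
  admissible u<m (ℕP.<⇒≢ (ℕP.<-trans u<m m<top)) m<top ∷ []
gaps-admissible rl u (v ∷ L) (u<m ∷ below) m<top ((u≢v ∷ _) ∷ distinct) =
  admissible u<m u≢v (placed L (All.head below)) ∷ gaps-admissible (u ∷ rl) v L below m<top distinct
  where
    placed : ∀ L → v < _ → Placed _ v (L ++ _ ∷ [])
    placed [] v<m = v<m
    placed (_ ∷ _) v<m = v<m

-- For a permutation w of {0, …, n-1} we use the top sentinel n + 2 and insert
-- n + 1 (the shifted new largest letter) into the gaps of the extension.
extension-gaps : ℕ → List ℕ → List Gap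
extension-gaps n w = gaps [] 0 (map suc w ++ suc (suc n) ∷ [])

shifted-below : ∀ {n w} → All (_< n) w → All (λ x → suc x < suc (suc n)) w
shifted-below = All.map (λ x<n → s≤s (s≤s (ℕP.<⇒≤ x<n)))

extension-admissible : ∀ {n w} → IsPerm n w → All (Admissible (suc n)) (extension-gaps n w)
extension-admissible {n} (isPerm distinct bounded _) =
  gaps-admissible [] 0 _ (s≤s z≤n ∷ All.map⁺ (All.map s≤s bounded)) (ℕP.n<1+n (suc n))
                  (All.map⁺ (All.map (λ _ ()) bounded) ∷ Unique.map⁺ ℕP.suc-injective distinct)

remaining-gaps : ∀ n p d c → p ℕ.+ (d ℕ.+ (p ℕ.+ 1 ℕ.+ (c ℕ.+ 0))) ≡ suc n → + c ≡ + n ℤ.- (+ 2 ℤ.* + p) ℤ.- + d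
remaining-gaps n p d c total = begin
  + c
    ≡⟨ solve-c (+ p) (+ d) (+ c) ⟩
  + (p ℕ.+ (d ℕ.+ (p ℕ.+ 1 ℕ.+ (c ℕ.+ 0)))) ℤ.- 1ℤ ℤ.- (+ 2 ℤ.* + p) ℤ.- + d
    ≡⟨ cong (λ t → + t ℤ.- 1ℤ ℤ.- (+ 2 ℤ.* + p) ℤ.- + d) (trans total (ℕP.+-comm 1 n)) ⟩
  + n ℤ.+ 1ℤ ℤ.- 1ℤ ℤ.- (+ 2 ℤ.* + p) ℤ.- + d
    ≡⟨ solve-n (+ n) (+ p) (+ d) ⟩
  + n ℤ.- (+ 2 ℤ.* + p) ℤ.- + d ∎
  where
    open ≡-Reasoning
    solve-c : ∀ p d c → c ≡ p ℤ.+ (d ℤ.+ (p ℤ.+ 1ℤ ℤ.+ (c ℤ.+ 0ℤ))) ℤ.- 1ℤ ℤ.- (+ 2 ℤ.* p) ℤ.- d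
    solve-c = solve-∀
    solve-n : ∀ n p d → n ℤ.+ 1ℤ ℤ.- 1ℤ ℤ.- (+ 2 ℤ.* p) ℤ.- d ≡ n ℤ.- (+ 2 ℤ.* p) ℤ.- d
    solve-n = solve-∀

kind-counts : ∀ {n w} → IsPerm n w → ∀ ℓ → + Σ (λ g → is (kind g) ℓ) (extension-gaps n w) ≡ degree ℓ (monomialOf n w)
kind-counts {n} {w} perm = degrees
  where
    L : List ℕ
    L = map suc w ++ suc (suc n) ∷ []
    G : List Gap
    G = extension-gaps n w
    adm : All (Admissible (suc n)) G
    adm = extension-admissible perm
    p≡ : exteriorPeaks w ≡ windows peak (0 ∷ L)
    p≡ = exteriorPeaks≡windows w (shifted-below (IsPerm.bounded perm))
    d≡ : properDoubleDescents w ≡ windows doubleDescent (0 ∷ L)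
    d≡ = properDoubleDescents≡windows-extend w (shifted-below (IsPerm.bounded perm))
    #_ : Letter → ℕ
    # ℓ = Σ (λ g → is (kind g) ℓ) G
    #X : # X ≡ exteriorPeaks w
    #X = trans (count-X [] 0 L) (sym p≡)
    #Y : # Y ≡ properDoubleDescents w
    #Y = trans (count-Y [] 0 L adm) (trans (cong (ℕ._+ windows doubleDescent (0 ∷ L)) (centredWindow-start doubleDescent 0 L)) (sym d≡))
    #Z : # Z ≡ exteriorPeaks w ℕ.+ 1
    #Z = trans (count-Z [] 0 (map suc w) (suc (suc n)) adm)
               (cong₂ (λ c p → c ℕ.+ p ℕ.+ 1) (centredWindow-start peak 0 L) (sym p≡))
    total : # X ℕ.+ (# Y ℕ.+ (# Z ℕ.+ (# W ℕ.+ 0))) ≡ suc n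
    total = begin
      Σ #_ letters ≡⟨ Σ-classes kind G ⟩
      length G     ≡⟨ length-gaps [] 0 L ⟩
      length L     ≡⟨ trans (length-++ (map suc w)) (cong (ℕ._+ 1) (trans (length-map suc w) (IsPerm.size perm))) ⟩
      n ℕ.+ 1      ≡⟨ ℕP.+-comm n 1 ⟩
      suc n ∎
      where open ≡-Reasoning
    degrees : ∀ ℓ → + # ℓ ≡ degree ℓ (monomialOf n w)
    degrees X = cong +_ #X
    degrees Y = cong +_ #Y
    degrees Z = cong +_ #Z
    degrees W = remaining-gaps n (exteriorPeaks w) (properDoubleDescents w) (# W)
                  (trans (cong₃ (λ x y z → x ℕ.+ (y ℕ.+ (z ℕ.+ (# W ℕ.+ 0)))) (sym #X) (sym #Y) (sym #Z)) total)

D-monomialOf : ∀ {n w} → IsPerm n w → ∀ e →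
  coeff (DTerm (1ℤ , monomialOf n w)) e ≡ + Σ (λ l → hits (monomialOf (suc n) l) e) (insertions n w)
D-monomialOf {n} {w} perm e = begin
  coeff (DTerm (1ℤ , E)) e
    ≡⟨ coeff-D-monomial E e #_ (kind-counts perm) ⟩
  + Σ (λ ℓ → # ℓ ℕ.* produced ℓ) letters
    ≡⟨ cong +_ (sym (Σ-by-letter kind produced G)) ⟩
  + Σ (λ g → produced (kind g)) G
    ≡⟨ cong +_ (Σ-cong (All.zipWith gap-monomial (extension-admissible perm , around-gaps [] 0 L))) ⟩
  + Σ (λ g → hits (windowMonomial (suc n) (fill (suc n) g)) e) G
    ≡⟨ cong +_ (sym (Σ-map (λ l → hits (windowMonomial (suc n) l) e) (fill (suc n)) G)) ⟩
  + Σ (λ l → hits (windowMonomial (suc n) l) e) (map (fill (suc n)) G)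
    ≡⟨ cong (λ ls → + Σ (λ l → hits (windowMonomial (suc n) l) e) ls) (sym (insertions-gaps B n [] 0 w)) ⟩
  + Σ (λ l → hits (windowMonomial (suc n) l) e) (map (extend B) (insertions n w))
    ≡⟨ cong +_ (Σ-map (λ l → hits (windowMonomial (suc n) l) e) (extend B) (insertions n w)) ⟩
  + Σ (λ l → hits (windowMonomial (suc n) (extend B l)) e) (insertions n w)
    ≡⟨ cong +_ (Σ-cong (All.map (λ {l} below → cong (λ E → hits E e) (sym (monomialOf≡windowMonomial (suc n) l below)))
                                 (insertions-All n w (ℕP.n<1+n (suc n)) (All.map (λ x<n → s≤s (ℕP.m≤n⇒m≤1+n x<n)) (IsPerm.bounded perm))))) ⟩
  + Σ (λ l → hits (monomialOf (suc n) l) e) (insertions n w) ∎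
  where
    open ≡-Reasoning
    B : ℕ
    B = suc (suc n)
    L : List ℕ
    L = map suc w ++ B ∷ []
    G : List Gap
    G = extension-gaps n w
    E : Exponent
    E = monomialOf n w
    #_ : Letter → ℕ
    # ℓ = Σ (λ g → is (kind g) ℓ) G
    produced : Letter → ℕ
    produced ℓ = hits (produce ℓ E) e
    gap-monomial : ∀ {g} → Admissible (suc n) g × around g ≡ 0 ∷ L → produced (kind g) ≡ hits (windowMonomial (suc n) (fill (suc n) g)) e
    gap-monomial {g} (adm , around≡) = cong (λ E′ → hits E′ e) (sym (begin
      windowMonomial (suc n) (fill (suc n) g)        ≡⟨ monomial-step (kind g) n (gap-step g adm) ⟩
      produce (kind g) (windowMonomial n (around g)) ≡⟨ cong (λ L′ → produce (kind g) (windowMonomial n L′)) around≡ ⟩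
      produce (kind g) (windowMonomial n (0 ∷ L))    ≡⟨ cong (produce (kind g)) (sym (monomialOf≡windowMonomial n w (shifted-below (IsPerm.bounded perm)))) ⟩
      produce (kind g) E ∎))

-- Permutations of {0, …, n-1}, each obtained in exactly one way by inserting
-- the largest letter n-1 into a permutation of {0, …, n-2}.
perms : ℕ → List (List ℕ)
perms zero = [] ∷ []
perms (suc n) = concatMap (insertions n) (perms n)

insertion-↭ : ∀ {M w l} → l ∈ insertions M w → l ↭ M ∷ w
insertion-↭ {w = []} (here refl) = ↭-refl
insertion-↭ {w = a ∷ w} (here refl) = ↭-refl
insertion-↭ {M} {a ∷ w} (there l∈) with ∈-map⁻ (a ∷_) l∈
... | l′ , l′∈ , refl = ↭-trans (↭-prep a (insertion-↭ l′∈)) (↭-swap a M ↭-refl)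

∈-insertions : ∀ M p s → p ++ M ∷ s ∈ insertions M (p ++ s)
∈-insertions M [] [] = here refl
∈-insertions M [] (a ∷ s) = here refl
∈-insertions M (a ∷ p) s = there (∈-map⁺ (a ∷_) (∈-insertions M p s))

remove : ℕ → List ℕ → List ℕ
remove M = filter (λ x → ¬? (x ℕ.≟ M))

remove-insertion : ∀ {M w l} → All (_≢ M) w → l ∈ insertions M w → remove M l ≡ w
remove-insertion {M} {[]} M∉w (here refl) = filter-reject (λ x → ¬? (x ℕ.≟ M)) (λ M≢M → M≢M refl)
remove-insertion {M} {a ∷ w} M∉w (here refl) = trans (filter-reject (λ x → ¬? (x ℕ.≟ M)) (λ M≢M → M≢M refl)) (filter-all (λ x → ¬? (x ℕ.≟ M)) M∉w)
remove-insertion {M} {a ∷ w} (a≢M ∷ M∉w) (there l∈) with ∈-map⁻ (a ∷_) l∈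
... | l′ , l′∈ , refl = trans (filter-accept (λ x → ¬? (x ℕ.≟ M)) a≢M) (cong (a ∷_) (remove-insertion M∉w l′∈))

insertions-unique : ∀ {M w} → All (_≢ M) w → Unique (insertions M w)
insertions-unique {w = []} [] = [] ∷ []
insertions-unique {M} {a ∷ w} (a≢M ∷ M∉w) =
  All.map⁺ (All.tabulate (λ _ M∷≡a∷ → a≢M (sym (∷-injectiveˡ M∷≡a∷)))) ∷ Unique.map⁺ ∷-injectiveʳ (insertions-unique M∉w)

IsPerm-↭ : ∀ {n xs ys} → xs ↭ ys → IsPerm n xs → IsPerm n ys
IsPerm-↭ xs↭ys (isPerm distinct bounded size) =
  isPerm (Unique-resp-↭ (↭⇒↭ₛ xs↭ys) distinct) (↭.All-resp-↭ xs↭ys bounded) (trans (sym (↭.↭-length xs↭ys)) size)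

IsPerm-∷ : ∀ {n w} → IsPerm n w → IsPerm (suc n) (n ∷ w)
IsPerm-∷ {n} (isPerm distinct bounded size) =
  isPerm (All.map (λ x<n n≡x → ℕP.<⇒≢ x<n (sym n≡x)) bounded ∷ distinct)
         (ℕP.n<1+n n ∷ All.map ℕP.m<n⇒m<1+n bounded) (cong suc size)

largest∉ : ∀ {n w} → IsPerm n w → All (_≢ n) w
largest∉ perm = All.map ℕP.<⇒≢ (IsPerm.bounded perm)

perms-IsPerm : ∀ n {l} → l ∈ perms n → IsPerm n l
perms-IsPerm zero (here refl) = isPerm [] [] refl
perms-IsPerm (suc n) l∈ with ∈-concat⁻′ (map (insertions n) (perms n)) l∈
... | ls , l∈ls , ls∈ with ∈-map⁻ (insertions n) ls∈
...   | w , w∈ , refl = IsPerm-↭ (↭-sym (insertion-↭ l∈ls)) (IsPerm-∷ (perms-IsPerm n w∈))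

lower : ∀ {k l} → All (_< suc k) l → k ∉ l → All (_< k) l
lower [] _ = []
lower (x≤k ∷ bounded) k∉ = ℕP.≤∧≢⇒< (ℕP.≤-pred x≤k) (λ x≡k → k∉ (here (sym x≡k))) ∷ lower bounded (λ k∈ → k∉ (there k∈))

distinct-≤ : ∀ k {l} → Unique l → All (_< k) l → length l ≤ k
distinct-≤ zero {[]} _ _ = z≤n
distinct-≤ zero {x ∷ l} _ (() ∷ _)
distinct-≤ (suc k) {l} distinct bounded with k ∈? l
... | no k∉l = ℕP.m≤n⇒m≤1+n (distinct-≤ k distinct (lower bounded k∉l))
... | yes k∈l with ∈-∃++ k∈l
...   | p , s , refl with Unique-resp-↭ (↭⇒↭ₛ (↭.shift k p s)) distinct | ↭.All-resp-↭ (↭.shift k p s) bounded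
...     | k∉ ∷ distinct′ | _ ∷ bounded′ =
  subst (_≤ suc k) (sym (↭.↭-length (↭.shift k p s))) (s≤s (distinct-≤ k distinct′ (lower bounded′ (All-≢⇒∉ k∉))))

largest∈ : ∀ {n l} → IsPerm (suc n) l → n ∈ l
largest∈ {n} {l} (isPerm distinct bounded size) with n ∈? l
... | yes n∈l = n∈l
... | no n∉l = ⊥-elim (ℕP.<-irrefl refl (subst (_≤ n) size (distinct-≤ n distinct (lower bounded n∉l))))

perms-complete : ∀ n {l} → IsPerm n l → l ∈ perms n
perms-complete zero {[]} _ = here refl
perms-complete (suc n) {l} perm with ∈-∃++ (largest∈ perm)
... | p , s , refl = ∈-concat⁺′ (∈-insertions n p s) (∈-map⁺ (insertions n) (perms-complete n rest))
  where
    rest : IsPerm n (p ++ s)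
    rest with IsPerm-↭ (↭.shift n p s) perm
    ... | isPerm (n∉ ∷ distinct) (_ ∷ bounded) size = isPerm distinct (lower bounded (All-≢⇒∉ n∉)) (ℕP.suc-injective size)

AllPairs-with : {A : Set} {P : A → Set} {R S : A → A → Set} {xs : List A} →
                All P xs → AllPairs R xs → (∀ {x y} → P x → P y → R x y → S x y) → AllPairs S xs
AllPairs-with [] [] implies = []
AllPairs-with (px ∷ pxs) (rx ∷ rxs) implies =
  All.zipWith (λ (py , r) → implies px py r) (pxs , rx) ∷ AllPairs-with pxs rxs implies

perms-unique : ∀ n → Unique (perms n)
perms-unique zero = [] ∷ []
perms-unique (suc n) =
  Unique.concat⁺ (All.map⁺ (All.tabulate (λ w∈ → insertions-unique (largest∉ (perms-IsPerm n w∈)))))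
                 (APP.map⁺ (AllPairs-with (All.tabulate (perms-IsPerm n)) (perms-unique n) disjoint))
  where
    disjoint : ∀ {w w′} → IsPerm n w → IsPerm n w′ → w ≢ w′ → Disjoint (insertions n w) (insertions n w′)
    disjoint perm perm′ w≢w′ (l∈ , l∈′) =
      w≢w′ (trans (sym (remove-insertion (largest∉ perm) l∈)) (remove-insertion (largest∉ perm′) l∈′))

permPoly : ℕ → LPoly
permPoly n = map (λ l → (1ℤ , monomialOf n l)) (perms n)

coeff-permPoly : ∀ n e → coeff (permPoly n) e ≡ + Σ (λ l → hits (monomialOf n l) e) (perms n)
coeff-permPoly n e = trans (coeff-terms (λ _ → 1) (monomialOf n) (perms n) e)
                           (cong +_ (Σ-pointwise (perms n) (λ l → ℕP.*-identityˡ (hits (monomialOf n l) e))))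

Dⁿz≡permPoly : ∀ n e → coeff (Dⁿ n zPoly) e ≡ + Σ (λ l → hits (monomialOf n l) e) (perms n)
Dⁿz≡permPoly zero e with (0ℤ , 0ℤ , 1ℤ , 0ℤ) ≟E e
... | yes _ = refl
... | no _ = refl
Dⁿz≡permPoly (suc n) e = begin
  coeff (D (Dⁿ n zPoly)) e
    ≡⟨ D-cong (Dⁿ n zPoly) (permPoly n) (λ e′ → trans (Dⁿz≡permPoly n e′) (sym (coeff-permPoly n e′))) e ⟩
  coeff (D (permPoly n)) e
    ≡⟨ cong (λ p → coeff p e) (concatMap-map DTerm (λ l → (1ℤ , monomialOf n l)) (perms n)) ⟩
  coeff (concatMap (λ w → DTerm (1ℤ , monomialOf n w)) (perms n)) e
    ≡⟨ coeff-concatMap _ (λ w → Σ (λ l → hits (monomialOf (suc n) l) e) (insertions n w)) e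
                       (All.tabulate (λ w∈ → D-monomialOf (perms-IsPerm n w∈) e)) ⟩
  + Σ (λ w → Σ (λ l → hits (monomialOf (suc n) l) e) (insertions n w)) (perms n)
    ≡⟨ cong +_ (sym (Σ-concatMap (λ l → hits (monomialOf (suc n) l) e) (insertions n) (perms n))) ⟩
  + Σ (λ l → hits (monomialOf (suc n) l) e) (perms (suc n)) ∎
  where open ≡-Reasoning

b2n-∧ : ∀ a b → b2n (a ∧ b) ≡ b2n a ℕ.* b2n b
b2n-∧ true b = sym (ℕP.+-identityʳ (b2n b))
b2n-∧ false b = refl

Σ-fibres : {A : Set} (s t : A → ℕ) (g : ℕ → ℕ → ℕ) (is js : List ℕ) (xs : List A) →
  Unique is → Unique js → All (λ x → s x ∈ is × t x ∈ js) xs →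
  Σ (λ i → Σ (λ j → length (filter (λ x → (s x ℕ.≟ i) ×-dec (t x ℕ.≟ j)) xs) ℕ.* g i j) js) is
  ≡ Σ (λ x → g (s x) (t x)) xs
Σ-fibres s t g is js xs unique-is unique-js ranges = begin
  Σ (λ i → Σ (λ j → length (filter (λ x → (s x ℕ.≟ i) ×-dec (t x ℕ.≟ j)) xs) ℕ.* g i j) js) is
    ≡⟨ Σ-pointwise is (λ i → Σ-pointwise js (λ j → cong (ℕ._* g i j)
         (trans (length-filter (λ x → (s x ℕ.≟ i) ×-dec (t x ℕ.≟ j)) xs)
                (Σ-pointwise xs (λ x → b2n-∧ (does (s x ℕ.≟ i)) (does (t x ℕ.≟ j))))))) ⟩
  Σ (λ i → Σ (λ j → Σ (λ x → δ (s x) i ℕ.* δ (t x) j) xs ℕ.* g i j) js) is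
    ≡⟨ Σ-pointwise is (λ i → Σ-pointwise js (λ j → sym (Σ-*ʳ (g i j) (λ x → δ (s x) i ℕ.* δ (t x) j) xs))) ⟩
  Σ (λ i → Σ (λ j → Σ (λ x → δ (s x) i ℕ.* δ (t x) j ℕ.* g i j) xs) js) is
    ≡⟨ Σ-pointwise is (λ i → Σ-swap (λ j x → δ (s x) i ℕ.* δ (t x) j ℕ.* g i j) js xs) ⟩
  Σ (λ i → Σ (λ x → Σ (λ j → δ (s x) i ℕ.* δ (t x) j ℕ.* g i j) js) xs) is
    ≡⟨ Σ-swap (λ i x → Σ (λ j → δ (s x) i ℕ.* δ (t x) j ℕ.* g i j) js) is xs ⟩
  Σ (λ x → Σ (λ i → Σ (λ j → δ (s x) i ℕ.* δ (t x) j ℕ.* g i j) js) is) xs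
    ≡⟨ Σ-cong (All.map collapse ranges) ⟩
  Σ (λ x → g (s x) (t x)) xs ∎
  where
    open ≡-Reasoning
    δ : ℕ → ℕ → ℕ
    δ k i = b2n (does (k ℕ.≟ i))
    collapse : ∀ {x} → s x ∈ is × t x ∈ js → Σ (λ i → Σ (λ j → δ (s x) i ℕ.* δ (t x) j ℕ.* g i j) js) is ≡ g (s x) (t x)
    collapse {x} (s∈ , t∈) = begin
      Σ (λ i → Σ (λ j → δ (s x) i ℕ.* δ (t x) j ℕ.* g i j) js) is
        ≡⟨ Σ-pointwise is (λ i → Σ-pointwise js (λ j → ℕP.*-assoc (δ (s x) i) (δ (t x) j) (g i j))) ⟩
      Σ (λ i → Σ (λ j → δ (s x) i ℕ.* (δ (t x) j ℕ.* g i j)) js) is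
        ≡⟨ Σ-pointwise is (λ i → Σ-*ˡ (δ (s x) i) (λ j → δ (t x) j ℕ.* g i j) js) ⟩
      Σ (λ i → δ (s x) i ℕ.* Σ (λ j → δ (t x) j ℕ.* g i j) js) is
        ≡⟨ Σ-pointwise is (λ i → cong (δ (s x) i ℕ.*_) (Σ-δ ℕ._≟_ (g i) t∈ unique-js)) ⟩
      Σ (λ i → δ (s x) i ℕ.* g i (t x)) is
        ≡⟨ Σ-δ ℕ._≟_ (λ i → g i (t x)) s∈ unique-is ⟩
      g (s x) (t x) ∎

toWord : ∀ {n k} → Vec (Fin n) k → List ℕ
toWord v = map toℕ (Vec.toList v)

toWord-injective : ∀ {n k} {v v′ : Vec (Fin n) k} → toWord v ≡ toWord v′ → v ≡ v′
toWord-injective {v = []ᵥ} {[]ᵥ} _ = refl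
toWord-injective {v = a ∷ᵥ v} {b ∷ᵥ v′} a∷v≡b∷v′ =
  cong₂ _∷ᵥ_ (toℕ-injective (∷-injectiveˡ a∷v≡b∷v′)) (toWord-injective (∷-injectiveʳ a∷v≡b∷v′))

toWord-IsPerm : ∀ {n} (v : Vec (Fin n) n) → Unique (Vec.toList v) → IsPerm n (toWord v)
toWord-IsPerm {n} v distinct = isPerm (Unique.map⁺ toℕ-injective distinct) (bounded v) (length-toWord v)
  where
    bounded : ∀ {k} (v : Vec (Fin n) k) → All (_< n) (toWord v)
    bounded []ᵥ = []
    bounded (a ∷ᵥ v) = toℕ<n a ∷ bounded v
    length-toWord : ∀ {k} (v : Vec (Fin n) k) → length (toWord v) ≡ k
    length-toWord []ᵥ = refl
    length-toWord (a ∷ᵥ v) = cong suc (length-toWord v)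

fromWord : ∀ {n} (l : List ℕ) → All (_< n) l → Vec (Fin n) (length l)
fromWord [] [] = []ᵥ
fromWord (x ∷ l) (x<n ∷ bounded) = fromℕ< x<n ∷ᵥ fromWord l bounded

toWord-fromWord : ∀ {n} (l : List ℕ) (bounded : All (_< n) l) → toWord (fromWord l bounded) ≡ l
toWord-fromWord [] [] = refl
toWord-fromWord (x ∷ l) (x<n ∷ bounded) = cong₂ _∷_ (toℕ-fromℕ< x<n) (toWord-fromWord l bounded)

allWords-complete : ∀ n k (v : Vec (Fin n) k) → v ∈ allWords n k
allWords-complete n zero []ᵥ = here refl
allWords-complete n (suc k) (i ∷ᵥ v) =
  ∈-concat⁺′ (∈-map⁺ (i ∷ᵥ_) (allWords-complete n k v)) (∈-map⁺ (λ i → map (i ∷ᵥ_) (allWords n k)) (∈-allFin i))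

allWords-unique : ∀ n k → Unique (allWords n k)
allWords-unique n zero = [] ∷ []
allWords-unique n (suc k) =
  Unique.concat⁺ (All.map⁺ (All.tabulate (λ _ → Unique.map⁺ Vec.∷-injectiveʳ (allWords-unique n k))))
                 (APP.map⁺ (AllPairs.map disjoint (Unique.allFin⁺ n)))
  where
    disjoint : ∀ {i j : Fin n} → i ≢ j → Disjoint (map (i ∷ᵥ_) (allWords n k)) (map (j ∷ᵥ_) (allWords n k))
    disjoint i≢j (v∈ , v∈′) with ∈-map⁻ _ v∈ | ∈-map⁻ _ v∈′
    ... | _ , _ , refl | _ , _ , i∷≡j∷ = i≢j (Vec.∷-injectiveˡ i∷≡j∷)

permutation-words : ℕ → List (List ℕ)
permutation-words n = map word (permutations n)

distinct? : ∀ {n} (v : Vec (Fin n) n) → Dec (Unique (Vec.toList v))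
distinct? v = unique? _≟F_ (Vec.toList v)

permutation-words-IsPerm : ∀ n {l} → l ∈ permutation-words n → IsPerm n l
permutation-words-IsPerm n l∈ with ∈-map⁻ word l∈
... | v , v∈ , refl = toWord-IsPerm v (proj₂ (∈-filter⁻ distinct? {xs = allWords n n} v∈))

permutation-words-complete : ∀ n {l} → IsPerm n l → l ∈ permutation-words n
permutation-words-complete .(length l) {l} (isPerm distinct bounded refl) =
  subst (_∈ permutation-words (length l)) (toWord-fromWord l bounded)
    (∈-map⁺ word (∈-filter⁺ distinct? (allWords-complete _ _ (fromWord l bounded))
                            (Unique.map⁻ (subst Unique (sym (toWord-fromWord l bounded)) distinct))))

permutation-words-unique : ∀ n → Unique (permutation-words n)
permutation-words-unique n = Unique.map⁺ toWord-injective (Unique.filter⁺ distinct? (allWords-unique n n))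

permutation-words↭perms : ∀ n → permutation-words n ↭ perms n
permutation-words↭perms n = ∼bag⇒↭ (unique∧set⇒bag (permutation-words-unique n) (perms-unique n)
  (mk⇔ (λ l∈ → perms-complete n (permutation-words-IsPerm n l∈))
       (λ l∈ → permutation-words-complete n (perms-IsPerm n l∈))))

exteriorPeaks-≤ : ∀ l → exteriorPeaks l ≤ length l
exteriorPeaks-≤ [] = z≤n
exteriorPeaks-≤ (a ∷ []) = z≤n
exteriorPeaks-≤ (a ∷ b ∷ r) =
  ℕP.m≤n⇒m≤1+n (ℕP.+-mono-≤ (b2n≤1 (b <ᵇ a)) (subst (_≤ length r) (sym (interiorPeaks≡windows (a ∷ b ∷ r))) (windows-≤ peak a b r)))

properDoubleDescents-≤ : ∀ l → properDoubleDescents l ≤ length l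
properDoubleDescents-≤ [] = z≤n
properDoubleDescents-≤ (a ∷ []) = z≤n
properDoubleDescents-≤ (a ∷ b ∷ r) =
  ℕP.m≤n⇒m≤1+n (ℕP.m≤n⇒m≤1+n (subst (_≤ length r) (sym (properDoubleDescents≡windows (a ∷ b ∷ r))) (windows-≤ doubleDescent a b r)))

coeff-P : ∀ n e → coeff (P n) e ≡ + Σ (λ l → hits (monomialOf n l) e) (perms n)
coeff-P n e = begin
  coeff (P n) e
    ≡⟨ coeff-concatMap (λ i → map (λ j → (+ Pcount n i j , monomial n i j)) range)
                       (λ i → Σ (λ j → Pcount n i j ℕ.* g i j) range) {range} e
                       (All.tabulate (λ {i} _ → coeff-terms (Pcount n i) (monomial n i) range e)) ⟩
  + Σ (λ i → Σ (λ j → Pcount n i j ℕ.* g i j) range) range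
    ≡⟨ cong +_ (Σ-fibres (λ v → exteriorPeaks (word v)) (λ v → properDoubleDescents (word v)) g range range (permutations n)
                          (Unique.upTo⁺ (suc n)) (Unique.upTo⁺ (suc n)) (All.tabulate in-range)) ⟩
  + Σ (λ v → hits (monomialOf n (word v)) e) (permutations n)
    ≡⟨ cong +_ (sym (Σ-map (λ l → hits (monomialOf n l) e) word (permutations n))) ⟩
  + Σ (λ l → hits (monomialOf n l) e) (permutation-words n)
    ≡⟨ cong +_ (Σ-↭ (λ l → hits (monomialOf n l) e) (permutation-words↭perms n)) ⟩
  + Σ (λ l → hits (monomialOf n l) e) (perms n) ∎
  where
    open ≡-Reasoning
    range : List ℕ
    range = upTo (suc n)
    g : ℕ → ℕ → ℕ
    g i j = hits (monomial n i j) e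
    in-range : ∀ {v} → v ∈ permutations n → exteriorPeaks (word v) ∈ range × properDoubleDescents (word v) ∈ range
    in-range {v} v∈ = ∈-upTo⁺ (s≤s (subst (exteriorPeaks (word v) ≤_) size (exteriorPeaks-≤ (word v))))
                    , ∈-upTo⁺ (s≤s (subst (properDoubleDescents (word v) ≤_) size (properDoubleDescents-≤ (word v))))
      where
        size : length (word v) ≡ n
        size = IsPerm.size (permutation-words-IsPerm n (∈-map⁺ word v∈))

theorem2p1 : (n : ℕ) (e : Exponent) → coeff (Dⁿ n zPoly) e ≡ coeff (P n) e
theorem2p1 n e = trans (Dⁿz≡permPoly n e) (sym (coeff-P n e))
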